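{- Consider the Game of Cards with $p$ players and $n=kp$ cards (so $n$ is a multiple of $p$). Then for every initial configuration $O$ there exists a player $i\in\{1,\dots,p\}$ such that in every sequence of moves starting from $O$, no move is made at position $i$ (player $i$ never gives a card to its neighbor).
   Context: Game of Cards: $p$ players sit in a cycle; indices are taken modulo $p$ (player $p$'s right neighbor is player $1$). A configuration is a vector $(a_1,\dots,a_p)$ of nonnegative integers with sum $n$. A move at position $i$ is allowed in $a$ iff $a_i>a_{i+1}$ (with $a_{p+1}=a_1$); it replaces $a_i$ by $a_i-1$ and $a_{i+1}$ by $a_{i+1}+1$, i.e. player $i$ gives a card to player $i+1$. -}

module Defs where

open import Data.Nat using (ℕ; zero; suc; _∸_; _<_; NonZero)
open import Data.Nat.DivMod using (_%_; m%n<n)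
open import Data.Fin using (Fin; toℕ; fromℕ<; _≟_)
open import Data.List using (List; tabulate)
open import Data.Nat.ListAction using (sum)
open import Relation.Nullary using (yes; no)

-- Players are Fin p (player i of the paper is Fin index i-1).
-- A configuration assigns a nonnegative number of cards to each player.
Config : ℕ → Set
Config p = Fin p → ℕ

total : ∀ {p} → Config p → ℕ
total a = sum (tabulate a)

next : ∀ {p} .{{_ : NonZero p}} → Fin p → Fin p
next {p} i = fromℕ< (m%n<n (suc (toℕ i)) p)

Allowed : ∀ {p} .{{_ : NonZero p}} → Config p → Fin p → Set
Allowed a i = a (next i) < a i

move : ∀ {p} .{{_ : NonZero p}} → Config p → Fin p → Config p
move a i j with j ≟ i
... | yes _ = a j ∸ 1
... | no _ with j ≟ next i
...   | yes _ = suc (a j)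
...   | no _ = a j

data MoveSeq {p : ℕ} .{{_ : NonZero p}} : Config p → List (Fin p) → Config p → Set where
  done : ∀ {a} → MoveSeq a List.[] a
  step : ∀ {a b ms} (i : Fin p) → Allowed a i →
         MoveSeq (move a i) ms b → MoveSeq a (i List.∷ ms) b

data Occurs {p : ℕ} (i : Fin p) : List (Fin p) → Set where
  here  : ∀ {ms} → Occurs i (i List.∷ ms)
  there : ∀ {j ms} → Occurs i ms → Occurs i (j List.∷ ms)

-- Since the number of cards is k p, the partial sums of a_j − k around the cycle close up, and
-- shifting them so that their minimum is 0 gives h : players → ℕ with
-- a_{i+1} + h_i = k + h_{i+1}.  A legal move at j forces h_j > 0 (otherwise
-- a_j ≤ k ≤ a_{j+1}), and after it the relation holds again with h_j lowered by
-- one.  Hence h stays nonnegative along any sequence of moves, changes only at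
-- positions where moves are made, and a player with h_i = 0 never moves.
module Submission where

open import Defs
open import Data.Nat using (ℕ; zero; suc; pred; _+_; _*_; _<_; z≤n; NonZero; >-nonZero⁻¹)
open import Data.Nat.Properties as ℕ
  using (suc-injective; +-suc; +-assoc; *-comm; +-identityʳ; m≤m+n; n≢0⇒n>0; <⇒≱; <-irrefl; module ≤-Reasoning)
open import Data.Nat.DivMod using (_%_; m%n<n; m<n⇒m%n≡m; n%n≡0)
open import Data.Nat.ListAction using (sum)
open import Data.Integer as ℤ using (ℤ; 0ℤ; +_; ∣_∣; _-_)
open import Data.Integer.Properties as ℤ
  using (pos-+; +-injective; 0≤i⇒+∣i∣≡i; i≤j⇒0≤j-i; ≤-totalOrder)
open import Data.Integer.Tactic.RingSolver using (solve-∀)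
open import Data.Fin using (Fin; zero; suc; toℕ; fromℕ; inject₁; _≟_)
open import Data.Fin.Properties as Fin using (toℕ-injective; toℕ-fromℕ<; toℕ-fromℕ; toℕ-inject₁; toℕ<n)
open import Data.List using (List; tabulate; allFin)
open import Data.List.Membership.Propositional.Properties using (∈-allFin)
import Data.List.Relation.Unary.All as All
open import Data.List.Extrema ≤-totalOrder using (argmin; f[argmin]≤f[xs])
open import Data.Vec.Functional using (updateAt)
open import Data.Vec.Functional.Properties using (updateAt-updates; updateAt-minimal)
open import Data.Product using (∃-syntax; _×_; _,_)
open import Function using (_∘_)
open import Relation.Nullary using (¬_; Dec; yes; no; contradiction)
open import Relation.Binary.PropositionalEquality
  using (_≡_; _≢_; refl; sym; trans; cong; cong₂; module ≡-Reasoning)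

data LastOrInject₁ {n : ℕ} : Fin (suc n) → Set where
  last   : LastOrInject₁ (fromℕ n)
  inject : (t : Fin n) → LastOrInject₁ (inject₁ t)

lastOrInject₁ : ∀ {n} (x : Fin (suc n)) → LastOrInject₁ x
lastOrInject₁ {zero}  zero    = last
lastOrInject₁ {suc n} zero    = inject zero
lastOrInject₁ {suc n} (suc x) with lastOrInject₁ x
... | last     = last
... | inject t = inject (suc t)

module _ {n : ℕ} where

  toℕ-next : (x : Fin (suc n)) → toℕ (next x) ≡ suc (toℕ x) % suc n
  toℕ-next x = toℕ-fromℕ< (m%n<n (suc (toℕ x)) (suc n))

  next-fromℕ : next (fromℕ n) ≡ zero
  next-fromℕ = toℕ-injective (begin
    toℕ (next (fromℕ n))        ≡⟨ toℕ-next (fromℕ n) ⟩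
    suc (toℕ (fromℕ n)) % suc n ≡⟨ cong (λ m → suc m % suc n) (toℕ-fromℕ n) ⟩
    suc n % suc n               ≡⟨ n%n≡0 (suc n) ⟩
    0                           ∎)
    where open ≡-Reasoning

  next-inject₁ : (t : Fin n) → next (inject₁ t) ≡ suc t
  next-inject₁ t = toℕ-injective (begin
    toℕ (next (inject₁ t))        ≡⟨ toℕ-next (inject₁ t) ⟩
    suc (toℕ (inject₁ t)) % suc n ≡⟨ cong (λ m → suc m % suc n) (toℕ-inject₁ t) ⟩
    suc (toℕ t) % suc n           ≡⟨ m<n⇒m%n≡m (toℕ<n (suc t)) ⟩
    suc (toℕ t)                   ∎)
    where open ≡-Reasoning

  next-surjective : (y : Fin (suc n)) → ∃[ x ] next x ≡ y
  next-surjective zero    = fromℕ n , next-fromℕ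
  next-surjective (suc t) = inject₁ t , next-inject₁ t

  next-injective : {x y : Fin (suc n)} → next x ≡ next y → x ≡ y
  next-injective {x} {y} eq with lastOrInject₁ x | lastOrInject₁ y
  ... | last     | last     = refl
  ... | last     | inject t with () ← trans (sym next-fromℕ) (trans eq (next-inject₁ t))
  ... | inject s | last     with () ← trans (sym next-fromℕ) (trans (sym eq) (next-inject₁ s))
  ... | inject s | inject t =
    cong inject₁ (Fin.suc-injective
      (trans (sym (next-inject₁ s)) (trans eq (next-inject₁ t))))

module _ {p : ℕ} .{{_ : NonZero p}} (a : Config p) (j : Fin p) where

  move-self : move a j j ≡ pred (a j)
  move-self with j ≟ j
  ... | yes _  = refl
  ... | no j≢j = contradiction refl j≢j

  move-next : next j ≢ j → move a j (next j) ≡ suc (a (next j))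
  move-next next≢j with next j ≟ j
  ... | yes next≡j = contradiction next≡j next≢j
  ... | no _ with next j ≟ next j
  ...   | yes _ = refl
  ...   | no next≢next = contradiction refl next≢next

  move-other : {y : Fin p} → y ≢ j → y ≢ next j → move a j y ≡ a y
  move-other {y} y≢j y≢next with y ≟ j
  ... | yes y≡j = contradiction y≡j y≢j
  ... | no _ with y ≟ next j
  ...   | yes y≡next = contradiction y≡next y≢next
  ...   | no _       = refl

allowed⇒next≢ : ∀ {p} .{{_ : NonZero p}} {a : Config p} {j : Fin p} → Allowed a j → next j ≢ j
allowed⇒next≢ {a = a} allowed next≡j = <-irrefl (cong a next≡j) allowed

suc+pred : ∀ m {n} → 0 < n → suc m + pred n ≡ m + n
suc+pred m {suc n} _ = sym (+-suc m n)

pred+≡+pred : ∀ {m l m′ l′} → 0 < m → 0 < l′ → m + l ≡ m′ + l′ → pred m + l ≡ m′ + pred l′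
pred+≡+pred {suc m} {l} {m′} {suc l′} _ _ eq = suc-injective (trans eq (+-suc m′ l′))

prefixSum : ∀ {n} → (Fin (suc n) → ℕ) → Fin (suc n) → ℕ
prefixSum         f zero    = f zero
prefixSum {suc n} f (suc x) = f zero + prefixSum (f ∘ suc) x

prefixSum-suc : ∀ {n} (f : Fin (suc n) → ℕ) (t : Fin n) →
                prefixSum f (suc t) ≡ prefixSum f (inject₁ t) + f (suc t)
prefixSum-suc {suc n} f zero    = refl
prefixSum-suc {suc n} f (suc t) =
  trans (cong (_+_ (f zero)) (prefixSum-suc (f ∘ suc) t)) (sym (+-assoc (f zero) _ _))

prefixSum-fromℕ : ∀ {n} (f : Fin (suc n) → ℕ) → prefixSum f (fromℕ n) ≡ sum (tabulate f)
prefixSum-fromℕ {zero}  f = sym (+-identityʳ (f zero))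
prefixSum-fromℕ {suc n} f = cong (_+_ (f zero)) (prefixSum-fromℕ (f ∘ suc))

minimum-exists : ∀ {n} (f : Fin (suc n) → ℤ) → ∃[ m ] ∀ x → f m ℤ.≤ f x
minimum-exists f =
  argmin f zero (allFin _) , λ x → All.lookup (f[argmin]≤f[xs] {f = f} zero (allFin _)) (∈-allFin x)

module _ {n : ℕ} (k : ℕ) where

  IsPotential : Config (suc n) → (Fin (suc n) → ℕ) → Set
  IsPotential a h = ∀ x → a (next x) + h x ≡ k + h (next x)

  module _ {a : Config (suc n)} {h : Fin (suc n) → ℕ} (pot : IsPotential a h) where

    zero-potential⇒¬allowed : ∀ {i} → h i ≡ 0 → ¬ Allowed a i
    zero-potential⇒¬allowed {i} hᵢ≡0 allowed with next-surjective i
    ... | i₋ , refl = <⇒≱ allowed (begin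
      a (next i₋)                      ≤⟨ m≤m+n _ (h i₋) ⟩
      a (next i₋) + h i₋               ≡⟨ pot i₋ ⟩
      k + h (next i₋)                  ≡⟨ cong (_+_ k) hᵢ≡0 ⟩
      k + 0                            ≤⟨ ℕ.+-monoʳ-≤ k z≤n ⟩
      k + h (next (next i₋))           ≡⟨ pot (next i₋) ⟨
      a (next (next i₋)) + h (next i₋) ≡⟨ cong (_+_ (a (next (next i₋)))) hᵢ≡0 ⟩
      a (next (next i₋)) + 0           ≡⟨ +-identityʳ _ ⟩
      a (next (next i₋))               ∎)
      where open ≤-Reasoning

    allowed⇒potential-positive : ∀ {j} → Allowed a j → 0 < h j
    allowed⇒potential-positive allowed = n≢0⇒n>0 (λ h≡0 → zero-potential⇒¬allowed h≡0 allowed)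

    move-potential : ∀ {j} → Allowed a j → IsPotential (move a j) (updateAt h j pred)
    move-potential {j} allowed = preserved
      where
      open ≡-Reasoning
      h′ = updateAt h j pred
      hⱼ>0 = allowed⇒potential-positive allowed

      preserved : IsPotential (move a j) h′
      preserved x = by-position (x ≟ j) (next x ≟ j)
        where
        by-position : Dec (x ≡ j) → Dec (next x ≡ j) → move a j (next x) + h′ x ≡ k + h′ (next x)
        by-position (yes refl) _ = begin
          move a j (next j) + h′ j      ≡⟨ cong₂ _+_ (move-next a j next≢j) (updateAt-updates j h) ⟩
          suc (a (next j)) + pred (h j) ≡⟨ suc+pred _ hⱼ>0 ⟩
          a (next j) + h j              ≡⟨ pot j ⟩
          k + h (next j)                ≡⟨ cong (_+_ k) (updateAt-minimal (next j) j h next≢j) ⟨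
          k + h′ (next j)               ∎
          where next≢j = allowed⇒next≢ {a = a} allowed
        by-position (no x≢j) (yes refl) = begin
          move a j j + h′ x             ≡⟨ cong₂ _+_ (move-self a j) (updateAt-minimal x j h x≢j) ⟩
          pred (a j) + h x              ≡⟨ pred+≡+pred (ℕ.m<n⇒0<n allowed) hⱼ>0 (pot x) ⟩
          k + pred (h j)                ≡⟨ cong (_+_ k) (updateAt-updates j h) ⟨
          k + h′ j                      ∎
        by-position (no x≢j) (no next≢j) = begin
          move a j (next x) + h′ x      ≡⟨ cong₂ _+_ (move-other a j next≢j (x≢j ∘ next-injective))
                                                     (updateAt-minimal x j h x≢j) ⟩
          a (next x) + h x              ≡⟨ pot x ⟩
          k + h (next x)                ≡⟨ cong (_+_ k) (updateAt-minimal (next x) j h next≢j) ⟨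
          k + h′ (next x)               ∎

  zero-potential⇒never-moves : ∀ {a b h ms i} → IsPotential a h → h i ≡ 0 → MoveSeq a ms b → ¬ Occurs i ms
  zero-potential⇒never-moves {a} {h = h} pot hᵢ≡0 (step _ allowed _) here =
    zero-potential⇒¬allowed {a} {h} pot hᵢ≡0 allowed
  zero-potential⇒never-moves {a} {h = h} {i = i} pot hᵢ≡0 (step j allowed moves) (there occurs) =
    zero-potential⇒never-moves (move-potential {a} {h} pot allowed)
      (trans (updateAt-minimal i j h i≢j) hᵢ≡0) moves occurs
    where
    i≢j : i ≢ j
    i≢j refl = zero-potential⇒¬allowed {a} {h} pot hᵢ≡0 allowed

  IsPotentialℤ : Config (suc n) → (Fin (suc n) → ℤ) → Set
  IsPotentialℤ a H = ∀ x → + a (next x) ℤ.+ H x ≡ + k ℤ.+ H (next x)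

  potentialℤ-minus-min : ∀ {a H m} → IsPotentialℤ a H → (∀ x → H m ℤ.≤ H x) →
                         IsPotential a (λ x → ∣ H x - H m ∣)
  potentialℤ-minus-min {a} {H} {m} pot H≥Hₘ x = +-injective (begin
    + (a (next x) + h x)              ≡⟨ pos-+ (a (next x)) (h x) ⟩
    + a (next x) ℤ.+ + h x            ≡⟨ cong (ℤ._+_ (+ a (next x))) (+h≡ x) ⟩
    + a (next x) ℤ.+ (H x - H m)      ≡⟨ shift (+ a (next x)) (H x) (H m) ⟩
    (+ a (next x) ℤ.+ H x) - H m      ≡⟨ cong (_- H m) (pot x) ⟩
    (+ k ℤ.+ H (next x)) - H m        ≡⟨ shift (+ k) (H (next x)) (H m) ⟨
    + k ℤ.+ (H (next x) - H m)        ≡⟨ cong (ℤ._+_ (+ k)) (+h≡ (next x)) ⟨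
    + k ℤ.+ + h (next x)              ≡⟨ pos-+ k (h (next x)) ⟨
    + (k + h (next x))                ∎)
    where
    open ≡-Reasoning
    h : Fin (suc n) → ℕ
    h y = ∣ H y - H m ∣
    +h≡ : ∀ y → + h y ≡ H y - H m
    +h≡ y = 0≤i⇒+∣i∣≡i (i≤j⇒0≤j-i (H≥Hₘ y))
    shift : ∀ u v w → u ℤ.+ (v - w) ≡ (u ℤ.+ v) - w
    shift = solve-∀

  potentialℤ-exists : ∀ a → total a ≡ k * suc n → ∃[ H ] IsPotentialℤ a H
  potentialℤ-exists a total≡ = H , λ x → increment⇒potential (+ a (next x)) (H x) (H-next x)
    where
    open ≡-Reasoning

    H : Fin (suc n) → ℤ
    H x = + prefixSum a x - + (suc (toℕ x) * k)

    increment⇒potential : ∀ A Hx {Hy} → Hy ≡ Hx ℤ.+ (A - + k) → A ℤ.+ Hx ≡ + k ℤ.+ Hy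
    increment⇒potential A Hx refl = lemma A Hx (+ k)
      where lemma : ∀ A Hx K → A ℤ.+ Hx ≡ K ℤ.+ (Hx ℤ.+ (A - K))
            lemma = solve-∀

    H-next : ∀ x → H (next x) ≡ H x ℤ.+ (+ a (next x) - + k)
    H-next x with lastOrInject₁ x
    ... | last rewrite next-fromℕ {n} = begin
      + a zero - + (k + 0)                        ≡⟨ cong (λ m → + a zero - + m) (+-identityʳ k) ⟩
      + a zero - + k                              ≡⟨ ℤ.+-identityˡ _ ⟨
      0ℤ ℤ.+ (+ a zero - + k)                     ≡⟨ cong (ℤ._+ (+ a zero - + k)) H-last ⟨
      H (fromℕ n) ℤ.+ (+ a zero - + k)            ∎
      where
      H-last : H (fromℕ n) ≡ 0ℤ
      H-last = begin
        + prefixSum a (fromℕ n) - + (suc (toℕ (fromℕ n)) * k) ≡⟨ cong₂ (λ P m → + P - + (suc m * k))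
                                                                   (trans (prefixSum-fromℕ a) total≡) (toℕ-fromℕ n) ⟩
        + (k * suc n) - + (suc n * k)                          ≡⟨ cong (λ m → + (k * suc n) - + m) (*-comm (suc n) k) ⟩
        + (k * suc n) - + (k * suc n)                          ≡⟨ ℤ.+-inverseʳ (+ (k * suc n)) ⟩
        0ℤ                                                     ∎
    ... | inject t rewrite next-inject₁ t = begin
      + prefixSum a (suc t) - + (k + suc (toℕ t) * k)  ≡⟨ cong₂ (λ P i → + P - + (k + suc i * k))
                                                            (prefixSum-suc a t) (sym (toℕ-inject₁ t)) ⟩
      + (P + A) - + (k + T)                             ≡⟨ cong₂ _-_ (pos-+ P A) (pos-+ k T) ⟩
      (+ P ℤ.+ + A) - (+ k ℤ.+ + T)                     ≡⟨ regroup (+ P) (+ A) (+ k) (+ T) ⟩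
      (+ P - + T) ℤ.+ (+ A - + k)                       ∎
      where
      P = prefixSum a (inject₁ t)
      A = a (suc t)
      T = suc (toℕ (inject₁ t)) * k
      regroup : ∀ P A K T → (P ℤ.+ A) - (K ℤ.+ T) ≡ (P - T) ℤ.+ (A - K)
      regroup = solve-∀

  potential-with-zero-exists : ∀ a → total a ≡ k * suc n → ∃[ h ] IsPotential a h × ∃[ i ] h i ≡ 0
  potential-with-zero-exists a total≡ with potentialℤ-exists a total≡
  ... | H , pot with minimum-exists H
  ... | m , H≥Hₘ =
    (λ x → ∣ H x - H m ∣) , potentialℤ-minus-min {a} {H} {m} pot H≥Hₘ , m , cong ∣_∣ (ℤ.+-inverseʳ (H m))

  never-moving-player : ∀ {a} → ∃[ h ] IsPotential a h × ∃[ i ] h i ≡ 0 →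
                        ∃[ i ] (∀ ms b → MoveSeq a ms b → ¬ Occurs i ms)
  never-moving-player {a} (h , pot , i , hᵢ≡0) = i , λ _ _ → zero-potential⇒never-moves {a} {h = h} pot hᵢ≡0

theorem5 : (p k : ℕ) .{{_ : NonZero p}} (O : Config p) → total O ≡ k * p →
    ∃[ i ] ((ms : List (Fin p)) (b : Config p) → MoveSeq O ms b → ¬ Occurs i ms)
theorem5 zero    k O _ with () ← >-nonZero⁻¹ 0
theorem5 (suc n) k O total≡ = never-moving-player k (potential-with-zero-exists k O total≡)
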